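{- Let $n\ge2$, $S\subseteq[n]$ and $i\in S$. The interval of the intersection lattice $\mathcal L(\mathcal D_{n,S})$ consisting of all intersection subspaces contained in $H_i$ is isomorphic to the intersection lattice $\mathcal L(\mathcal B_{n-1})$, the isomorphism being given by restricting the arrangement $\mathcal D_{n,S}$ to $H_i$. In particular, for any $S_1,S_2\subseteq[n]$ and any subspaces $F,G$ belonging to both $\mathcal L(\mathcal D_{n,S_1})$ and $\mathcal L(\mathcal D_{n,S_2})$ with $F\preceq G$ and $F\subseteq H_i$ for some $i\in S_1\cap S_2$, the intervals $[F,G]$ in $\mathcal L(\mathcal D_{n,S_1})$ and in $\mathcal L(\mathcal D_{n,S_2})$ are isomorphic.
   Context: For $S\subseteq[n]$, $\mathcal D_{n,S}$ is the arrangement in $\mathbb R^n$ consisting of the hyperplanes $\{x_k\pm x_l=0\}$ ($1\le k<l\le n$) and $H_k=\{x_k=0\}$ for $k\in S$. $\mathcal B_{n-1}$ is the arrangement in $\mathbb R^{n-1}$ with normals $e_k\pm e_l$ ($k<l$) and $e_k$ (all $k$). The intersection lattice $\mathcal L(\mathcal A)$ is the set of all intersections of subsets of $\mathcal A$ (including $\mathbb R^n$), ordered by reverse inclusion ($X\preceq Y$ iff $Y\subseteq X$); $[F,G]=\{X\in\mathcal L(\mathcal A):F\preceq X\preceq G\}$.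
   Formalization: The arrangements $\mathcal D_{n,S}$ and $\mathcal B_{n-1}$ and their intersection lattices are taken over the rationals, in ℚ^n and ℚ^(n-1) rather than ℝ^n and ℝ^(n-1). -}

module Defs where

open import Level using (Level)
open import Data.Nat using (ℕ; suc; _≤_)
open import Data.Fin using (Fin; _<_)
open import Data.Fin.Subset using (Subset; _∈_; ⊤)
open import Data.Rational using (ℚ; 0ℚ; _+_; _-_)
open import Data.Product using (Σ; ∃; _×_; proj₁)
open import Data.List using (List)
open import Data.List.Relation.Unary.All using (All)
open import Data.Vec.Functional using (insertAt)
open import Relation.Binary.PropositionalEquality using (_≡_)

-- Points of Q^n (Q in place of R).
Point : ℕ → Set
Point n = Fin n → ℚ

Subspace : ℕ → Set₁
Subspace n = Point n → Set

_⊆ₛ_ : ∀ {n} → Subspace n → Subspace n → Set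
X ⊆ₛ Y = ∀ x → X x → Y x

_≈ₛ_ : ∀ {n} → Subspace n → Subspace n → Set
X ≈ₛ Y = (X ⊆ₛ Y) × (Y ⊆ₛ X)

_⪯_ : ∀ {n} → Subspace n → Subspace n → Set
X ⪯ Y = Y ⊆ₛ X

record Arrangement (n : ℕ) : Set₁ where
  field
    Hyp   : Set
    hyper : Hyp → Subspace n
open Arrangement public

H : ∀ {n} → Fin n → Subspace n
H k x = x k ≡ 0ℚ

data HypD (n : ℕ) (S : Subset n) : Set where
  plus  : (k l : Fin n) → k < l → HypD n S
  minus : (k l : Fin n) → k < l → HypD n S
  coord : (k : Fin n) → k ∈ S → HypD n S

hyperD : ∀ {n S} → HypD n S → Subspace n
hyperD (plus k l _)  x = x k + x l ≡ 0ℚ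
hyperD (minus k l _) x = x k - x l ≡ 0ℚ
hyperD (coord k _)   x = x k ≡ 0ℚ

D : (n : ℕ) → Subset n → Arrangement n
D n S = record { Hyp = HypD n S ; hyper = hyperD }

B : (m : ℕ) → Arrangement m
B m = D m ⊤

-- Membership in the intersection lattice L(A): X is the intersection of a
-- finite subfamily T of A (the empty family gives the whole space).
InL : ∀ {n} → Arrangement n → Subspace n → Set
InL A X = Σ (List (Hyp A)) λ T →
  ∀ x → (X x → All (λ h → hyper A h x) T) × (All (λ h → hyper A h x) T → X x)

Interval : ∀ {n} → Arrangement n → Subspace n → Subspace n → Subspace n → Set
Interval A F G X = InL A X × (F ⪯ X) × (X ⪯ G)

Elt : ∀ {n} → (Subspace n → Set) → Set₁
Elt {n} P = Σ (Subspace n) P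

record OrderIso {m n : ℕ} (P : Subspace m → Set) (Q : Subspace n → Set) : Set₁ where
  field
    to      : Elt P → Elt Q
    from    : Elt Q → Elt P
    to-mono   : ∀ a b → proj₁ a ⪯ proj₁ b → proj₁ (to a) ⪯ proj₁ (to b)
    from-mono : ∀ a b → proj₁ a ⪯ proj₁ b → proj₁ (from a) ⪯ proj₁ (from b)
    from-to : ∀ a → proj₁ (from (to a)) ≈ₛ proj₁ a
    to-from : ∀ b → proj₁ (to (from b)) ≈ₛ proj₁ b
open OrderIso public

-- Restriction to H_i, identified with Q^{m} by deleting coordinate i:
-- y ∈ restrict i X  iff  (y with 0 inserted at position i) ∈ X.
restrict : ∀ {m} → Fin (suc m) → Subspace (suc m) → Subspace m
restrict i X y = X (insertAt y i 0ℚ)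

-- Inside H_i the hyperplane x_k = 0 coincides with x_k + x_i = 0, so every hyperplane of
-- D_{n,S} agrees there with one of D_{n,S'} whenever i ∈ S'; this makes the choice of S
-- irrelevant below H_i. Deleting the coordinate x_i = 0 turns x_k ± x_l = 0 into either
-- x_k' ± x_l' = 0 or a coordinate hyperplane of Q^(n-1), i.e. a hyperplane of B_{n-1},
-- and conversely every hyperplane of B_{n-1} lifts to one of D_{n,S} inside H_i. Hence
-- intersections correspond, and the correspondence preserves inclusion both ways.
module Submission where

open import Defs
open import Data.Nat using (ℕ; suc; _≤_)
open import Data.Fin using (Fin; punchIn; punchOut; _≟_) renaming (_<_ to _<ᶠ_)
open import Data.Fin.Subset using (Subset; _∈_) renaming (⊤ to Full)
open import Data.Product using (Σ; _×_; proj₁; _,_; proj₂)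

import Data.Nat.Properties as ℕ
open import Data.Empty using (⊥-elim)
open import Data.Unit using (⊤; tt)
open import Data.Fin.Properties using (<-cmp; <-irrefl; punchIn-cancel-≤; punchOut-cancel-≤; punchIn-punchOut)
open import Data.Fin.Subset.Properties using (∈⊤)
open import Data.Rational using (ℚ; 0ℚ; _+_; _-_; -_)
open import Data.Rational.Properties using (+-identityˡ; +-identityʳ; neg-injective)
open import Data.List using (List; []; _∷_; [_]; _++_; concatMap)
open import Data.List.Relation.Unary.All using (All; []; _∷_) renaming (map to All-map)
open import Data.List.Relation.Unary.All.Properties using (++⁺; ++⁻ˡ; ++⁻ʳ; concat⁺; concat⁻; map⁺; map⁻; singleton⁻)
open import Data.Vec.Functional using (insertAt; removeAt)
open import Data.Vec.Functional.Properties using (insertAt-lookup; insertAt-punchIn; insertAt-removeAt; removeAt-insertAt)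
open import Function using (_∘_)
open import Function.Bundles using (_⇔_; mk⇔; module Equivalence)
open import Function.Properties.Equivalence using () renaming (refl to ⇔-refl; sym to ⇔-sym; trans to ⇔-trans)
open import Relation.Binary.Definitions using (tri<; tri≈; tri>)
open import Relation.Binary.PropositionalEquality using (_≡_; _≢_; _≗_; refl; sym; trans; cong; cong₂; subst)
open import Relation.Nullary using (yes; no)

open Equivalence using () renaming (to to ⇔-to; from to ⇔-from)

Sat : ∀ {n} (A : Arrangement n) → List (Hyp A) → Subspace n
Sat A T x = All (λ h → hyper A h x) T

Sat-singleton : ∀ {n} (A : Arrangement n) (h : Hyp A) (x : Point n) → hyper A h x ⇔ Sat A [ h ] x
Sat-singleton A h x = mk⇔ (_∷ []) singleton⁻

Sat-concatMap : ∀ {n n'} (A : Arrangement n) (A' : Arrangement n') (t : Hyp A → List (Hyp A'))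
  {x : Point n} {y : Point n'} → (∀ h → hyper A h x ⇔ Sat A' (t h) y) →
  ∀ T → Sat A T x ⇔ Sat A' (concatMap t T) y
Sat-concatMap A A' t t-correct T = mk⇔
  (concat⁺ ∘ map⁺ ∘ All-map (λ {h} → ⇔-to (t-correct h)))
  (All-map (λ {h} → ⇔-from (t-correct h)) ∘ map⁻ ∘ concat⁻)

≈ₛ-refl : ∀ {n} {X : Subspace n} → X ≈ₛ X
≈ₛ-refl = (λ _ Xx → Xx) , (λ _ Xx → Xx)

InL-resp-≈ : ∀ {n} (A : Arrangement n) {X Y : Subspace n} → X ≈ₛ Y → InL A X → InL A Y
InL-resp-≈ A (X⊆Y , Y⊆X) (T , X≡T) = T , λ x →
  (λ Yx → proj₁ (X≡T x) (Y⊆X x Yx)) , (λ Tx → X⊆Y x (proj₂ (X≡T x) Tx))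

InL-whole : ∀ {n} (A : Arrangement n) → InL A (λ _ → ⊤)
InL-whole A = [] , λ _ → (λ _ → []) , (λ _ → tt)

InL-pullback : ∀ {n n'} (A : Arrangement n) (A' : Arrangement n') (f : Point n' → Point n)
  {Z : Subspace n'} → InL A' Z → (t : Hyp A → List (Hyp A')) →
  (∀ h y → Z y → hyper A h (f y) ⇔ Sat A' (t h) y) →
  {X : Subspace n} → InL A X → InL A' (λ y → Z y × X (f y))
InL-pullback A A' f {Z} (U , Z≡U) t t-correct (T , X≡T) = U ++ concatMap t T , λ y →
  (λ (Zy , Xfy) → ++⁺ (proj₁ (Z≡U y) Zy) (⇔-to (translate y Zy) (proj₁ (X≡T (f y)) Xfy))) ,
  (λ sat → let Zy = proj₂ (Z≡U y) (++⁻ˡ U sat) in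
     Zy , proj₂ (X≡T (f y)) (⇔-from (translate y Zy) (++⁻ʳ U sat)))
  where
  translate : ∀ y → Z y → Sat A T (f y) ⇔ Sat A' (concatMap t T) y
  translate y Zy = Sat-concatMap A A' t (λ h → t-correct h y Zy) T

hyperD-resp-≗ : ∀ {n S} (h : HypD n S) {x x' : Point n} → x ≗ x' → hyperD h x → hyperD h x'
hyperD-resp-≗ (plus k l _)  x≗x' = trans (sym (cong₂ _+_ (x≗x' k) (x≗x' l)))
hyperD-resp-≗ (minus k l _) x≗x' = trans (sym (cong₂ _-_ (x≗x' k) (x≗x' l)))
hyperD-resp-≗ (coord k _)   x≗x' = trans (sym (x≗x' k))

InL-D-resp-≗ : ∀ {n S} {X : Subspace n} → InL (D n S) X → {x x' : Point n} → x ≗ x' → X x → X x'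
InL-D-resp-≗ (T , X≡T) {x} {x'} x≗x' Xx =
  proj₂ (X≡T x') (All-map (λ {h} → hyperD-resp-≗ h x≗x') (proj₁ (X≡T x) Xx))

InL-D-H : ∀ {n S} {i : Fin n} → i ∈ S → InL (D n S) (H i)
InL-D-H i∈S = [ coord _ i∈S ] , λ x → (_∷ []) , singleton⁻

≡0-resp-≡ : {a b : ℚ} → a ≡ b → (a ≡ 0ℚ) ⇔ (b ≡ 0ℚ)
≡0-resp-≡ a≡b = mk⇔ (trans (sym a≡b)) (trans a≡b)

0+b≡0⇔b≡0 : ∀ b → (0ℚ + b ≡ 0ℚ) ⇔ (b ≡ 0ℚ)
0+b≡0⇔b≡0 b = ≡0-resp-≡ (+-identityˡ b)

0-b≡0⇔b≡0 : ∀ b → (0ℚ - b ≡ 0ℚ) ⇔ (b ≡ 0ℚ)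
0-b≡0⇔b≡0 b = ⇔-trans (≡0-resp-≡ (+-identityˡ (- b))) (mk⇔ neg-injective (cong (-_)))

sumHyp : ∀ {n S} (k i : Fin n) → k ≢ i → HypD n S
sumHyp k i k≢i with <-cmp k i
... | tri< k<i _ _ = plus k i k<i
... | tri≈ _ k≡i _ = ⊥-elim (k≢i k≡i)
... | tri> _ _ i<k = plus i k i<k

sumHyp-on-H : ∀ {n S} (k i : Fin n) (k≢i : k ≢ i) (x : Point n) → H i x →
  hyperD (sumHyp {S = S} k i k≢i) x ⇔ (x k ≡ 0ℚ)
sumHyp-on-H k i k≢i x xᵢ≡0 with <-cmp k i
... | tri< _ _ _   = ≡0-resp-≡ (trans (cong (x k +_) xᵢ≡0) (+-identityʳ (x k)))
... | tri≈ _ k≡i _ = ⊥-elim (k≢i k≡i)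
... | tri> _ _ _   = ≡0-resp-≡ (trans (cong (_+ x k) xᵢ≡0) (+-identityˡ (x k)))

retargetHyp : ∀ {n S S'} {i : Fin n} → i ∈ S' → HypD n S → HypD n S'
retargetHyp i∈S' (plus k l k<l)  = plus k l k<l
retargetHyp i∈S' (minus k l k<l) = minus k l k<l
retargetHyp {i = i} i∈S' (coord k _) with k ≟ i
... | yes refl = coord k i∈S'
... | no k≢i   = sumHyp k i k≢i

retargetHyp-on-H : ∀ {n S S'} {i : Fin n} (i∈S' : i ∈ S') (h : HypD n S) (x : Point n) → H i x →
  hyperD h x ⇔ hyperD (retargetHyp i∈S' h) x
retargetHyp-on-H i∈S' (plus k l k<l)  x xᵢ≡0 = ⇔-refl
retargetHyp-on-H i∈S' (minus k l k<l) x xᵢ≡0 = ⇔-refl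
retargetHyp-on-H {i = i} i∈S' (coord k _) x xᵢ≡0 with k ≟ i
... | yes refl = ⇔-refl
... | no k≢i   = ⇔-sym (sumHyp-on-H k i k≢i x xᵢ≡0)

InL-D-retarget : ∀ {n S S'} {i : Fin n} → i ∈ S' → {X : Subspace n} → X ⊆ₛ H i →
  InL (D n S) X → InL (D n S') X
InL-D-retarget {n} {S} {S'} i∈S' X⊆Hᵢ L =
  InL-resp-≈ (D n S') ((λ _ → proj₂) , (λ x Xx → X⊆Hᵢ x Xx , Xx))
    (InL-pullback (D n S) (D n S') (λ x → x) (InL-D-H i∈S') ([_] ∘ retargetHyp i∈S')
      (λ h x xᵢ≡0 → ⇔-trans (retargetHyp-on-H i∈S' h x xᵢ≡0) (Sat-singleton (D n S') _ x)) L)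

Interval-retarget : ∀ {n S₁ S₂} {i : Fin n} → i ∈ S₁ → i ∈ S₂ → (F G : Subspace n) → F ⊆ₛ H i →
  OrderIso (Interval (D n S₁) F G) (Interval (D n S₂) F G)
Interval-retarget i∈S₁ i∈S₂ F G F⊆Hᵢ = record
  { to        = λ (X , L , F⪯X , X⪯G) → X , InL-D-retarget i∈S₂ (below F⪯X) L , F⪯X , X⪯G
  ; from      = λ (X , L , F⪯X , X⪯G) → X , InL-D-retarget i∈S₁ (below F⪯X) L , F⪯X , X⪯G
  ; to-mono   = λ _ _ a⪯b → a⪯b
  ; from-mono = λ _ _ a⪯b → a⪯b
  ; from-to   = λ _ → ≈ₛ-refl
  ; to-from   = λ _ → ≈ₛ-refl
  }
  where
  below : {X : Subspace _} → F ⪯ X → X ⊆ₛ H _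
  below F⪯X x Xx = F⊆Hᵢ x (F⪯X x Xx)

embed : ∀ {m} → Fin (suc m) → Subspace m → Subspace (suc m)
embed i Y x = H i x × Y (removeAt x i)

module _ {m : ℕ} (i : Fin (suc m)) where

  insertAt-kept : (y : Point m) {k : Fin (suc m)} (i≢k : i ≢ k) → insertAt y i 0ℚ k ≡ y (punchOut i≢k)
  insertAt-kept y i≢k = subst (λ j → insertAt y i 0ℚ j ≡ y (punchOut i≢k))
    (punchIn-punchOut i≢k) (insertAt-punchIn y i 0ℚ (punchOut i≢k))

  insertAt-removeAt-on-H : (x : Point (suc m)) → H i x → insertAt (removeAt x i) i 0ℚ ≗ x
  insertAt-removeAt-on-H x xᵢ≡0 j =
    subst (λ v → insertAt (removeAt x i) i v j ≡ x j) xᵢ≡0 (insertAt-removeAt x i j)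

  punchOut-mono-< : {k l : Fin (suc m)} (i≢k : i ≢ k) (i≢l : i ≢ l) → k <ᶠ l → punchOut i≢k <ᶠ punchOut i≢l
  punchOut-mono-< i≢k i≢l k<l = ℕ.≰⇒> (ℕ.<⇒≱ k<l ∘ punchOut-cancel-≤ i≢l i≢k)

  punchIn-mono-< : {k l : Fin m} → k <ᶠ l → punchIn i k <ᶠ punchIn i l
  punchIn-mono-< {k} {l} k<l = ℕ.≰⇒> (ℕ.<⇒≱ k<l ∘ punchIn-cancel-≤ i l k)

  restrictPair : (c : (k l : Fin m) → k <ᶠ l → HypD m Full) →
    (k l : Fin (suc m)) → k <ᶠ l → List (HypD m Full)
  restrictPair c k l k<l with i ≟ k | i ≟ l
  ... | yes _   | yes _   = []
  ... | yes _   | no i≢l  = [ coord (punchOut i≢l) ∈⊤ ]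
  ... | no i≢k  | yes _   = [ coord (punchOut i≢k) ∈⊤ ]
  ... | no i≢k  | no i≢l  = [ c (punchOut i≢k) (punchOut i≢l) (punchOut-mono-< i≢k i≢l k<l) ]

  restrictPair-correct : (_∙_ : ℚ → ℚ → ℚ) → (∀ a → a ∙ 0ℚ ≡ a) → (∀ b → (0ℚ ∙ b ≡ 0ℚ) ⇔ (b ≡ 0ℚ)) →
    (c : (k l : Fin m) → k <ᶠ l → HypD m Full) →
    (∀ k l k<l y → hyperD (c k l k<l) y ⇔ (y k ∙ y l ≡ 0ℚ)) →
    (k l : Fin (suc m)) (k<l : k <ᶠ l) (y : Point m) →
    (insertAt y i 0ℚ k ∙ insertAt y i 0ℚ l ≡ 0ℚ) ⇔ Sat (B m) (restrictPair c k l k<l) y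
  restrictPair-correct _∙_ ∙-identityʳ 0∙b≡0⇔b≡0 c c-def k l k<l y with i ≟ k | i ≟ l
  ... | yes refl | yes refl = ⊥-elim (<-irrefl refl k<l)
  ... | yes refl | no i≢l
    rewrite insertAt-lookup y i 0ℚ | insertAt-kept y i≢l =
      ⇔-trans (0∙b≡0⇔b≡0 _) (Sat-singleton (B m) _ y)
  ... | no i≢k   | yes refl
    rewrite insertAt-lookup y i 0ℚ | insertAt-kept y i≢k =
      ⇔-trans (≡0-resp-≡ (∙-identityʳ _)) (Sat-singleton (B m) _ y)
  ... | no i≢k   | no i≢l
    rewrite insertAt-kept y i≢k | insertAt-kept y i≢l =
      ⇔-trans (⇔-sym (c-def _ _ _ y)) (Sat-singleton (B m) _ y)

  restrictHyp : ∀ {S} → HypD (suc m) S → List (HypD m Full)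
  restrictHyp (plus k l k<l)  = restrictPair plus k l k<l
  restrictHyp (minus k l k<l) = restrictPair minus k l k<l
  restrictHyp (coord k _) with i ≟ k
  ... | yes _  = []
  ... | no i≢k = [ coord (punchOut i≢k) ∈⊤ ]

  restrictHyp-correct : ∀ {S} (h : HypD (suc m) S) (y : Point m) →
    hyperD h (insertAt y i 0ℚ) ⇔ Sat (B m) (restrictHyp h) y
  restrictHyp-correct (plus k l k<l) =
    restrictPair-correct _+_ +-identityʳ 0+b≡0⇔b≡0 plus (λ _ _ _ _ → ⇔-refl) k l k<l
  restrictHyp-correct (minus k l k<l) =
    restrictPair-correct _-_ +-identityʳ 0-b≡0⇔b≡0 minus (λ _ _ _ _ → ⇔-refl) k l k<l
  restrictHyp-correct (coord k _) y with i ≟ k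
  ... | yes refl rewrite insertAt-lookup y i 0ℚ = mk⇔ (λ _ → []) (λ _ → refl)
  ... | no i≢k rewrite insertAt-kept y i≢k = Sat-singleton (B m) _ y

  punchInHyp : ∀ {S} → HypD m S → HypD (suc m) Full
  punchInHyp (plus k l k<l)  = plus (punchIn i k) (punchIn i l) (punchIn-mono-< k<l)
  punchInHyp (minus k l k<l) = minus (punchIn i k) (punchIn i l) (punchIn-mono-< k<l)
  punchInHyp (coord k _)     = coord (punchIn i k) ∈⊤

  punchInHyp-correct : ∀ {S} (h : HypD m S) (x : Point (suc m)) →
    hyperD h (removeAt x i) ⇔ hyperD (punchInHyp h) x
  punchInHyp-correct (plus k l k<l)  x = ⇔-refl
  punchInHyp-correct (minus k l k<l) x = ⇔-refl
  punchInHyp-correct (coord k _)     x = ⇔-refl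

  InL-restrict : ∀ {S} {X : Subspace (suc m)} → InL (D (suc m) S) X → InL (B m) (restrict i X)
  InL-restrict {S} L =
    InL-resp-≈ (B m) ((λ _ → proj₂) , (λ _ Xy → tt , Xy))
      (InL-pullback (D (suc m) S) (B m) (λ y → insertAt y i 0ℚ) (InL-whole (B m)) restrictHyp
        (λ h y _ → restrictHyp-correct h y) L)

  InL-embed : ∀ {S} → i ∈ S → {Y : Subspace m} → InL (B m) Y → InL (D (suc m) S) (embed i Y)
  InL-embed {S} i∈S =
    InL-pullback (B m) (D (suc m) S) (λ x → removeAt x i) (InL-D-H i∈S)
      ([_] ∘ retargetHyp i∈S ∘ punchInHyp)
      (λ h x xᵢ≡0 → ⇔-trans (punchInHyp-correct h x)
        (⇔-trans (retargetHyp-on-H i∈S (punchInHyp h) x xᵢ≡0) (Sat-singleton (D (suc m) S) _ x)))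

  embed-restrict : ∀ {S} {X : Subspace (suc m)} → InL (D (suc m) S) X → X ⊆ₛ H i →
    embed i (restrict i X) ≈ₛ X
  embed-restrict L X⊆Hᵢ =
    (λ x (xᵢ≡0 , X-x) → InL-D-resp-≗ L (insertAt-removeAt-on-H x xᵢ≡0) X-x) ,
    (λ x Xx → X⊆Hᵢ x Xx , InL-D-resp-≗ L (sym ∘ insertAt-removeAt-on-H x (X⊆Hᵢ x Xx)) Xx)

  restrict-embed : {Y : Subspace m} → InL (B m) Y → restrict i (embed i Y) ≈ₛ Y
  restrict-embed L =
    (λ y (_ , Yy) → InL-D-resp-≗ L (removeAt-insertAt y i 0ℚ) Yy) ,
    (λ y Yy → insertAt-lookup y i 0ℚ , InL-D-resp-≗ L (sym ∘ removeAt-insertAt y i 0ℚ) Yy)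

  restrictionIso : ∀ {S} → i ∈ S → OrderIso (λ X → InL (D (suc m) S) X × (X ⊆ₛ H i)) (InL (B m))
  restrictionIso i∈S = record
    { to        = λ X → restrict i (proj₁ X) , InL-restrict (proj₁ (proj₂ X))
    ; from      = λ Y → embed i (proj₁ Y) , InL-embed i∈S (proj₂ Y) , (λ _ → proj₁)
    ; to-mono   = λ _ _ b⊆a y → b⊆a _
    ; from-mono = λ _ _ b⊆a x (xᵢ≡0 , Yx) → xᵢ≡0 , b⊆a _ Yx
    ; from-to   = λ (X , L , X⊆Hᵢ) → embed-restrict L X⊆Hᵢ
    ; to-from   = λ (Y , L) → restrict-embed L
    }

lemma4p36 :
    ((m : ℕ) → 1 ≤ m → (S : Subset (suc m)) (i : Fin (suc m)) → i ∈ S →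
      Σ (OrderIso (λ X → InL (D (suc m) S) X × (X ⊆ₛ H i)) (InL (B m))) λ φ →
        ∀ X → proj₁ (to φ X) ≈ₛ restrict i (proj₁ X))
    ×
    ((n : ℕ) → 2 ≤ n → (S₁ S₂ : Subset n) (i : Fin n) → i ∈ S₁ → i ∈ S₂ →
      (F G : Subspace n) →
      InL (D n S₁) F → InL (D n S₂) F → InL (D n S₁) G → InL (D n S₂) G →
      F ⪯ G → F ⊆ₛ H i →
      OrderIso (Interval (D n S₁) F G) (Interval (D n S₂) F G))
lemma4p36 =
  (λ m _ S i i∈S → restrictionIso i i∈S , λ _ → ≈ₛ-refl) ,
  (λ n _ S₁ S₂ i i∈S₁ i∈S₂ F G _ _ _ _ _ F⊆Hᵢ → Interval-retarget i∈S₁ i∈S₂ F G F⊆Hᵢ)
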